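{- Let $n\ge1$ and let $\widehat\Phi_n$ be the undirected graph with vertex set $\{0,1\}^n$ in which distinct vertices $x,y$ are adjacent if and only if $y-x$ or $x-y$ is an alternating sequence. Let $\theta(a_1,\ldots,a_n)=(\overline{a_n},a_1,\ldots,a_{n-1})$, where $\overline{x}=1-x$, and $\tau(a_1,\ldots,a_n)=(a_n,\ldots,a_2,a_1)$. Then $\theta$ and $\tau$ induce an action of the dihedral group $D_{2n}$ on $\widehat\Phi_n$ as a group of automorphisms; that is, there is a group homomorphism from $D_{2n}=\langle r,s\mid r^{2n}=s^2=1,\ srs^{ -1}=r^{ -1}\rangle$ to the automorphism group of $\widehat\Phi_n$ sending $r\mapsto\theta$ and $s\mapsto\tau$.
   Context: A sequence $(\alpha_1,\ldots,\alpha_n)$ is alternating if each $\alpha_i\in\{1,0,-1\}$ and its nonzero entries, read left to right, form the pattern $1,-1,1,-1,\ldots,-1,1$. Here $D_{2n}$ denotes the dihedral group with rotation of order $2n$ (order $4n$). The graph $\widehat\Phi_n$ is the Hasse diagram of the poset on $\{0,1\}^n$ in which $y$ covers $x$ iff $y-x$ is alternating. -}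

module Defs where

open import Data.Bool using (Bool; true; false; not; _xor_)
open import Data.Nat using (ℕ; zero; suc; _*_; _∸_; _%_)
import Data.Nat as ℕ
open import Data.Nat.DivMod using (m%n<n)
open import Data.Fin using (Fin; toℕ; fromℕ<)
open import Data.Integer using (ℤ; +_; -[1+_]; _-_)
open import Data.List using (List; []; _∷_)
open import Data.Vec using (Vec; zipWith; toList; last; init; reverse; _∷_)
open import Data.Product using (_×_; _,_; ∃)
open import Data.Sum using (_⊎_)
open import Relation.Binary.PropositionalEquality using (_≡_; _≢_)
open import Function.Bundles using (_⇔_)
open import Function.Definitions using (Bijective)

nonzeros : List ℤ → List ℤ
nonzeros []              = []
nonzeros (+ zero ∷ xs)   = nonzeros xs
nonzeros (z ∷ xs)        = z ∷ nonzeros xs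

altPattern : ℕ → List ℤ
altPattern zero    = + 1 ∷ []
altPattern (suc k) = + 1 ∷ -[1+ 0 ] ∷ altPattern k

data IsSign : ℤ → Set where
  sgn+ : IsSign (+ 1)
  sgn0 : IsSign (+ 0)
  sgn- : IsSign -[1+ 0 ]

data AllSigns : List ℤ → Set where
  []  : AllSigns []
  _∷_ : ∀ {z zs} → IsSign z → AllSigns zs → AllSigns (z ∷ zs)

Alternating : List ℤ → Set
Alternating s = AllSigns s × ∃ λ k → nonzeros s ≡ altPattern k

Vertex : ℕ → Set
Vertex n = Vec Bool n

bit : Bool → ℤ
bit false = + 0
bit true  = + 1

diff : ∀ {n} → Vertex n → Vertex n → List ℤ
diff y x = toList (zipWith (λ b a → bit b - bit a) y x)

Adj : ∀ {n} → Vertex n → Vertex n → Set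
Adj x y = x ≢ y × (Alternating (diff y x) ⊎ Alternating (diff x y))

IsAutomorphism : ∀ {n} → (Vertex n → Vertex n) → Set
IsAutomorphism {n} f =
  Bijective _≡_ _≡_ f × (∀ (x y : Vertex n) → Adj x y ⇔ Adj (f x) (f y))

θ : ∀ {m} → Vertex (suc m) → Vertex (suc m)
θ a = not (last a) ∷ init a

τ : ∀ {n} → Vertex n → Vertex n
τ = reverse

-- The dihedral group D_{2n} (order 4n), concretely:
-- the element (e , k) stands for r^k s^e  (e = true means s^1),
-- with k taken modulo 2n.  Using s r^b = r^{-b} s:
--   (r^a s^e)(r^b s^f) = r^{a + (-1)^e b} s^{e+f}.

Dih : ℕ → Set
Dih m = Bool × Fin (2 * suc m)

modN : ∀ m → ℕ → Fin (2 * suc m)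
modN m k = fromℕ< (m%n<n k (2 * suc m))

dmul : ∀ {m} → Dih m → Dih m → Dih m
dmul {m} (e , a) (f , b) = (e xor f , modN m (toℕ a ℕ.+ b′ e))
  where
  b′ : Bool → ℕ
  b′ false = toℕ b
  b′ true  = (2 * suc m) ∸ toℕ b

dr : ∀ {m} → Dih m
dr {m} = (false , modN m 1)

ds : ∀ {m} → Dih m
ds {m} = (true , modN m 0)

record DihedralAction (m : ℕ) : Set where
  field
    act     : Dih m → Vertex (suc m) → Vertex (suc m)
    act-aut : ∀ g → IsAutomorphism (act g)
    act-hom : ∀ g h x → act (dmul g h) x ≡ act g (act h x)

-- θ moves the last letter to the front and complements it, so θⁿ is complementation and θ
-- has order 2n; moreover θ τ θ = τ, which is the dihedral relation s r s⁻¹ = r⁻¹.  Reversal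
-- preserves adjacency because the pattern 1,-1,…,1 is a palindrome.  For θ, look at the last
-- entry d of y - x: if d = 0 it simply moves to the front; if d = 1 then x - y starts with 1
-- followed by the negated, still alternating, rest; and d = -1 cannot end an alternating sequence.
module Submission where

open import Defs
open import Data.Bool using (Bool; true; false; not)
open import Data.Bool.Properties using (not-involutive)
open import Data.Nat using (ℕ; zero; suc; _+_; _*_; _∸_; _%_; _/_; _≤_; s≤s; z≤n; NonZero)
open import Data.Nat.Properties using (m∸n+n≡m; m+[n∸m]≡n; <⇒≤; +-identityʳ)
open import Data.Nat.DivMod using (m%n<n; m≡m%n+[m/n]*n)
open import Data.Fin using (toℕ)
open import Data.Fin.Properties using (toℕ-fromℕ<; toℕ<n)
open import Data.Integer using (ℤ; +_; -[1+_]; -_; _-_)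
open import Data.List using (List; []; _∷_; _++_; _∷ʳ_; length; map; reverse)
import Data.List.Properties as List
open import Data.Vec using (Vec; toList; initLast)
  renaming ([] to []ᵥ; _∷_ to _∷ᵥ_; _∷ʳ_ to _∷ʳᵥ_)
import Data.Vec.Properties as Vec
open import Data.Product using (Σ; _×_; _,_)
open import Data.Sum using (_⊎_; inj₁; inj₂; swap)
open import Function using (_∘_; id)
open import Function.Bundles using (mk⇔)
open import Relation.Nullary using (¬_; contradiction)
open import Relation.Binary.PropositionalEquality
open ≡-Reasoning

module _ {A : Set} where
  open import Function.Endo.Propositional A public using (_^_)
  open import Function.Endo.Propositional A using (^-homo)

  ^-+ : ∀ (f : A → A) p q x → (f ^ (p + q)) x ≡ (f ^ p) ((f ^ q) x)
  ^-+ f p q = cong-app (^-homo f p q)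

  ^-sucʳ : ∀ (f : A → A) k x → (f ^ suc k) x ≡ (f ^ k) (f x)
  ^-sucʳ f zero    x = refl
  ^-sucʳ f (suc k) x = cong f (^-sucʳ f k x)

  module Periodic (f : A → A) (N : ℕ) .{{_ : NonZero N}} (period : ∀ x → (f ^ N) x ≡ x) where

    ^-*-period : ∀ q x → (f ^ (q * N)) x ≡ x
    ^-*-period zero    x = refl
    ^-*-period (suc q) x = begin
      (f ^ (N + q * N)) x        ≡⟨ ^-+ f N (q * N) x ⟩
      (f ^ N) ((f ^ (q * N)) x)  ≡⟨ cong (f ^ N) (^-*-period q x) ⟩
      (f ^ N) x                  ≡⟨ period x ⟩
      x                          ∎

    ^-% : ∀ j x → (f ^ (j % N)) x ≡ (f ^ j) x
    ^-% j x = begin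
      (f ^ (j % N)) x                        ≡⟨ cong (f ^ (j % N)) (^-*-period (j / N) x) ⟨
      (f ^ (j % N)) ((f ^ ((j / N) * N)) x)  ≡⟨ ^-+ f (j % N) _ x ⟨
      (f ^ (j % N + (j / N) * N)) x          ≡⟨ cong (λ k → (f ^ k) x) (m≡m%n+[m/n]*n j N) ⟨
      (f ^ j) x                              ∎

    ^-∸-inverseˡ : ∀ {k} → k ≤ N → ∀ x → (f ^ (N ∸ k)) ((f ^ k) x) ≡ x
    ^-∸-inverseˡ {k} k≤N x = begin
      (f ^ (N ∸ k)) ((f ^ k) x)  ≡⟨ ^-+ f (N ∸ k) k x ⟨
      (f ^ (N ∸ k + k)) x        ≡⟨ cong (λ j → (f ^ j) x) (m∸n+n≡m k≤N) ⟩
      (f ^ N) x                  ≡⟨ period x ⟩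
      x                          ∎

    ^-∸-inverseʳ : ∀ {k} → k ≤ N → ∀ x → (f ^ k) ((f ^ (N ∸ k)) x) ≡ x
    ^-∸-inverseʳ {k} k≤N x = begin
      (f ^ k) ((f ^ (N ∸ k)) x)  ≡⟨ ^-+ f k (N ∸ k) x ⟨
      (f ^ (k + (N ∸ k))) x      ≡⟨ cong (λ j → (f ^ j) x) (m+[n∸m]≡n k≤N) ⟩
      (f ^ N) x                  ≡⟨ period x ⟩
      x                          ∎

∷ʳ-elim : ∀ {A : Set} {n} (P : Vec A (suc n) → Set) → (∀ xs c → P (xs ∷ʳᵥ c)) → ∀ x → P x
∷ʳ-elim P P-∷ʳ x with initLast x
... | xs , c , refl = P-∷ʳ xs c

negate : List ℤ → List ℤ
negate = map (-_)

nonzeros-++ : ∀ l r → nonzeros (l ++ r) ≡ nonzeros l ++ nonzeros r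
nonzeros-++ []                r = refl
nonzeros-++ (+ zero ∷ l)      r = nonzeros-++ l r
nonzeros-++ (z@(+ suc _) ∷ l) r = cong (z ∷_) (nonzeros-++ l r)
nonzeros-++ (z@(-[1+ _ ]) ∷ l) r = cong (z ∷_) (nonzeros-++ l r)

nonzeros-negate : ∀ l → nonzeros (negate l) ≡ negate (nonzeros l)
nonzeros-negate []             = refl
nonzeros-negate (+ zero ∷ l)   = nonzeros-negate l
nonzeros-negate (+ suc n ∷ l)  = cong (-[1+ n ] ∷_) (nonzeros-negate l)
nonzeros-negate (-[1+ n ] ∷ l) = cong (+ suc n ∷_) (nonzeros-negate l)

nonzeros-reverse : ∀ l → nonzeros (reverse l) ≡ reverse (nonzeros l)
nonzeros-reverse []      = refl
nonzeros-reverse (z ∷ l) = begin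
  nonzeros (reverse (z ∷ l))                 ≡⟨ cong nonzeros (List.unfold-reverse z l) ⟩
  nonzeros (reverse l ∷ʳ z)                  ≡⟨ nonzeros-++ (reverse l) (z ∷ []) ⟩
  nonzeros (reverse l) ++ nonzeros (z ∷ [])  ≡⟨ cong (_++ nonzeros (z ∷ [])) (nonzeros-reverse l) ⟩
  reverse (nonzeros l) ++ nonzeros (z ∷ [])  ≡⟨ snoc z ⟩
  reverse (nonzeros (z ∷ l))                 ∎
  where
  snoc : ∀ z → reverse (nonzeros l) ++ nonzeros (z ∷ []) ≡ reverse (nonzeros (z ∷ l))
  snoc (+ zero)    = List.++-identityʳ _
  snoc z@(+ suc _) = sym (List.unfold-reverse z (nonzeros l))
  snoc z@(-[1+ _ ]) = sym (List.unfold-reverse z (nonzeros l))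

AllSigns-++⁻ˡ : ∀ l {r} → AllSigns (l ++ r) → AllSigns l
AllSigns-++⁻ˡ []      _       = []
AllSigns-++⁻ˡ (_ ∷ l) (s ∷ a) = s ∷ AllSigns-++⁻ˡ l a

AllSigns-++ : ∀ {l r} → AllSigns l → AllSigns r → AllSigns (l ++ r)
AllSigns-++ []      b = b
AllSigns-++ (s ∷ a) b = s ∷ AllSigns-++ a b

AllSigns-negate : ∀ {l} → AllSigns l → AllSigns (negate l)
AllSigns-negate []         = []
AllSigns-negate (sgn+ ∷ a) = sgn- ∷ AllSigns-negate a
AllSigns-negate (sgn0 ∷ a) = sgn0 ∷ AllSigns-negate a
AllSigns-negate (sgn- ∷ a) = sgn+ ∷ AllSigns-negate a

AllSigns-reverse : ∀ {l} → AllSigns l → AllSigns (reverse l)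
AllSigns-reverse []                = []
AllSigns-reverse {z ∷ l} (s ∷ a) =
  subst AllSigns (sym (List.unfold-reverse z l)) (AllSigns-++ (AllSigns-reverse a) (s ∷ []))

altPrefix : ℕ → List ℤ
altPrefix zero    = []
altPrefix (suc k) = + 1 ∷ -[1+ 0 ] ∷ altPrefix k

altPattern-∷ʳ : ∀ k → altPattern k ≡ altPrefix k ∷ʳ + 1
altPattern-∷ʳ zero    = refl
altPattern-∷ʳ (suc k) = cong (λ t → + 1 ∷ -[1+ 0 ] ∷ t) (altPattern-∷ʳ k)

altPattern-negate : ∀ k → + 1 ∷ negate (altPrefix k) ≡ altPattern k
altPattern-negate zero    = refl
altPattern-negate (suc k) = cong (λ t → + 1 ∷ -[1+ 0 ] ∷ t) (altPattern-negate k)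

altPattern-suc : ∀ k → altPattern (suc k) ≡ altPattern k ++ -[1+ 0 ] ∷ + 1 ∷ []
altPattern-suc zero    = refl
altPattern-suc (suc k) = cong (λ t → + 1 ∷ -[1+ 0 ] ∷ t) (altPattern-suc k)

altPattern-reverse : ∀ k → reverse (altPattern k) ≡ altPattern k
altPattern-reverse zero    = refl
altPattern-reverse (suc k) = begin
  reverse (+ 1 ∷ -[1+ 0 ] ∷ altPattern k)
    ≡⟨ List.reverse-++ (+ 1 ∷ -[1+ 0 ] ∷ []) (altPattern k) ⟩
  reverse (altPattern k) ++ -[1+ 0 ] ∷ + 1 ∷ []
    ≡⟨ cong (_++ -[1+ 0 ] ∷ + 1 ∷ []) (altPattern-reverse k) ⟩
  altPattern k ++ -[1+ 0 ] ∷ + 1 ∷ []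
    ≡⟨ altPattern-suc k ⟨
  altPattern (suc k)
    ∎

Alternating-reverse : ∀ {l} → Alternating l → Alternating (reverse l)
Alternating-reverse {l} (signs , k , eq) =
  AllSigns-reverse signs , k , trans (nonzeros-reverse l) (trans (cong reverse eq) (altPattern-reverse k))

Alternating-∷ʳ0 : ∀ l → Alternating (l ∷ʳ + 0) → Alternating (+ 0 ∷ l)
Alternating-∷ʳ0 l (signs , k , eq) =
  sgn0 ∷ AllSigns-++⁻ˡ l signs , k , trans (sym (trans (nonzeros-++ l (+ 0 ∷ [])) (List.++-identityʳ _))) eq

Alternating-∷ʳ1 : ∀ l → Alternating (l ∷ʳ + 1) → Alternating (+ 1 ∷ negate l)
Alternating-∷ʳ1 l (signs , k , eq) =
  sgn+ ∷ AllSigns-negate (AllSigns-++⁻ˡ l signs) , k ,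
  trans (cong (+ 1 ∷_) (trans (nonzeros-negate l) (cong negate nonzeros-l))) (altPattern-negate k)
  where
  nonzeros-l : nonzeros l ≡ altPrefix k
  nonzeros-l = List.∷ʳ-injectiveˡ (nonzeros l) (altPrefix k)
    (trans (sym (nonzeros-++ l (+ 1 ∷ []))) (trans eq (altPattern-∷ʳ k)))

¬Alternating-∷ʳ-1 : ∀ l → ¬ Alternating (l ∷ʳ -[1+ 0 ])
¬Alternating-∷ʳ-1 l (_ , k , eq)
  with () ← List.∷ʳ-injectiveʳ (nonzeros l) (altPrefix k)
              (trans (sym (nonzeros-++ l (-[1+ 0 ] ∷ []))) (trans eq (altPattern-∷ʳ k)))

diff-∷ʳ : ∀ {n} (ys xs : Vertex n) b a → diff (ys ∷ʳᵥ b) (xs ∷ʳᵥ a) ≡ diff ys xs ∷ʳ (bit b - bit a)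
diff-∷ʳ []ᵥ       []ᵥ       b a = refl
diff-∷ʳ (y ∷ᵥ ys) (x ∷ᵥ xs) b a = cong ((bit y - bit x) ∷_) (diff-∷ʳ ys xs b a)

diff-swap : ∀ {n} (xs ys : Vertex n) → diff xs ys ≡ negate (diff ys xs)
diff-swap []ᵥ       []ᵥ       = refl
diff-swap (x ∷ᵥ xs) (y ∷ᵥ ys) = cong₂ _∷_ (bit-swap x y) (diff-swap xs ys)
  where
  bit-swap : ∀ a b → bit a - bit b ≡ - (bit b - bit a)
  bit-swap false false = refl
  bit-swap false true  = refl
  bit-swap true  false = refl
  bit-swap true  true  = refl

diff-τ : ∀ {n} (ys xs : Vertex n) → diff (τ ys) (τ xs) ≡ reverse (diff ys xs)
diff-τ []ᵥ       []ᵥ       = refl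
diff-τ (y ∷ᵥ ys) (x ∷ᵥ xs) = begin
  diff (τ (y ∷ᵥ ys)) (τ (x ∷ᵥ xs))         ≡⟨ cong₂ diff (Vec.reverse-∷ y ys) (Vec.reverse-∷ x xs) ⟩
  diff (τ ys ∷ʳᵥ y) (τ xs ∷ʳᵥ x)           ≡⟨ diff-∷ʳ (τ ys) (τ xs) y x ⟩
  diff (τ ys) (τ xs) ∷ʳ (bit y - bit x)    ≡⟨ cong (_∷ʳ (bit y - bit x)) (diff-τ ys xs) ⟩
  reverse (diff ys xs) ∷ʳ (bit y - bit x)  ≡⟨ List.unfold-reverse _ (diff ys xs) ⟨
  reverse (diff (y ∷ᵥ ys) (x ∷ᵥ xs))       ∎

θ-∷ʳ : ∀ {m} (xs : Vertex m) c → θ (xs ∷ʳᵥ c) ≡ not c ∷ᵥ xs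
θ-∷ʳ xs c = cong₂ (λ a b → not a ∷ᵥ b) (Vec.last-∷ʳ c xs) (Vec.init-∷ʳ c xs)

θ-τ-θ : ∀ {m} (x : Vertex (suc m)) → θ (τ (θ x)) ≡ τ x
θ-τ-θ = ∷ʳ-elim (λ x → θ (τ (θ x)) ≡ τ x) λ xs c → begin
  θ (τ (θ (xs ∷ʳᵥ c)))  ≡⟨ cong (θ ∘ τ) (θ-∷ʳ xs c) ⟩
  θ (τ (not c ∷ᵥ xs))   ≡⟨ cong θ (Vec.reverse-∷ (not c) xs) ⟩
  θ (τ xs ∷ʳᵥ not c)    ≡⟨ θ-∷ʳ (τ xs) (not c) ⟩
  not (not c) ∷ᵥ τ xs   ≡⟨ cong (_∷ᵥ τ xs) (not-involutive c) ⟩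
  c ∷ᵥ τ xs             ≡⟨ Vec.reverse-involutive (c ∷ᵥ τ xs) ⟨
  τ (τ (c ∷ᵥ τ xs))     ≡⟨ cong τ (Vec.reverse-∷ c (τ xs)) ⟩
  τ (τ (τ xs) ∷ʳᵥ c)    ≡⟨ cong (λ v → τ (v ∷ʳᵥ c)) (Vec.reverse-involutive xs) ⟩
  τ (xs ∷ʳᵥ c)          ∎

θᴸ : List Bool → List Bool
θᴸ l with reverse l
... | []    = []
... | c ∷ r = not c ∷ reverse r

θᴸ-∷ʳ : ∀ l c → θᴸ (l ∷ʳ c) ≡ not c ∷ l
θᴸ-∷ʳ l c rewrite List.reverse-++ l (c ∷ []) = cong (not c ∷_) (List.reverse-involutive l)

toList-θ : ∀ {m} (x : Vertex (suc m)) → toList (θ x) ≡ θᴸ (toList x)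
toList-θ = ∷ʳ-elim (λ x → toList (θ x) ≡ θᴸ (toList x)) λ xs c → begin
  toList (θ (xs ∷ʳᵥ c))   ≡⟨ cong toList (θ-∷ʳ xs c) ⟩
  not c ∷ toList xs       ≡⟨ θᴸ-∷ʳ (toList xs) c ⟨
  θᴸ (toList xs ∷ʳ c)     ≡⟨ cong θᴸ (Vec.toList-∷ʳ c xs) ⟨
  θᴸ (toList (xs ∷ʳᵥ c))  ∎

toList-θ^ : ∀ {m} k (x : Vertex (suc m)) → toList ((θ ^ k) x) ≡ (θᴸ ^ k) (toList x)
toList-θ^ zero    x = refl
toList-θ^ (suc k) x = trans (toList-θ ((θ ^ k) x)) (cong θᴸ (toList-θ^ k x))

-- Each application of θᴸ carries one more letter of zs, complemented, across to the front.
θᴸ^-++-reverse : ∀ zs xs → (θᴸ ^ length zs) (xs ++ reverse zs) ≡ map not (reverse zs) ++ xs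
θᴸ^-++-reverse []       xs = List.++-identityʳ xs
θᴸ^-++-reverse (z ∷ zs) xs = begin
  (θᴸ ^ suc (length zs)) (xs ++ reverse (z ∷ zs))
    ≡⟨ ^-sucʳ θᴸ (length zs) _ ⟩
  (θᴸ ^ length zs) (θᴸ (xs ++ reverse (z ∷ zs)))
    ≡⟨ cong (λ t → (θᴸ ^ length zs) (θᴸ (xs ++ t))) (List.unfold-reverse z zs) ⟩
  (θᴸ ^ length zs) (θᴸ (xs ++ (reverse zs ∷ʳ z)))
    ≡⟨ cong ((θᴸ ^ length zs) ∘ θᴸ) (List.++-assoc xs (reverse zs) (z ∷ [])) ⟨
  (θᴸ ^ length zs) (θᴸ ((xs ++ reverse zs) ∷ʳ z))
    ≡⟨ cong (θᴸ ^ length zs) (θᴸ-∷ʳ (xs ++ reverse zs) z) ⟩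
  (θᴸ ^ length zs) ((not z ∷ xs) ++ reverse zs)
    ≡⟨ θᴸ^-++-reverse zs (not z ∷ xs) ⟩
  map not (reverse zs) ++ (not z ∷ xs)
    ≡⟨ List.++-assoc (map not (reverse zs)) (not z ∷ []) xs ⟨
  (map not (reverse zs) ∷ʳ not z) ++ xs
    ≡⟨ cong (_++ xs) (List.map-++ not (reverse zs) (z ∷ [])) ⟨
  map not (reverse zs ∷ʳ z) ++ xs
    ≡⟨ cong (λ t → map not t ++ xs) (List.unfold-reverse z zs) ⟨
  map not (reverse (z ∷ zs)) ++ xs
    ∎

θᴸ^length≡map-not : ∀ l → (θᴸ ^ length l) l ≡ map not l
θᴸ^length≡map-not l = begin
  (θᴸ ^ length l) l
    ≡⟨ cong₂ (θᴸ ^_) (List.length-reverse l) (List.reverse-involutive l) ⟨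
  (θᴸ ^ length (reverse l)) ([] ++ reverse (reverse l))
    ≡⟨ θᴸ^-++-reverse (reverse l) [] ⟩
  map not (reverse (reverse l)) ++ []
    ≡⟨ List.++-identityʳ _ ⟩
  map not (reverse (reverse l))
    ≡⟨ cong (map not) (List.reverse-involutive l) ⟩
  map not l
    ∎

θᴸ^length+length≡id : ∀ l → (θᴸ ^ (length l + length l)) l ≡ l
θᴸ^length+length≡id l = begin
  (θᴸ ^ (length l + length l)) l
    ≡⟨ ^-+ θᴸ (length l) (length l) l ⟩
  (θᴸ ^ length l) ((θᴸ ^ length l) l)
    ≡⟨ cong (θᴸ ^ length l) (θᴸ^length≡map-not l) ⟩
  (θᴸ ^ length l) (map not l)
    ≡⟨ cong (λ k → (θᴸ ^ k) (map not l)) (List.length-map not l) ⟨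
  (θᴸ ^ length (map not l)) (map not l)
    ≡⟨ θᴸ^length≡map-not (map not l) ⟩
  map not (map not l)
    ≡⟨ List.map-∘ l ⟨
  map (not ∘ not) l
    ≡⟨ List.map-cong not-involutive l ⟩
  map id l
    ≡⟨ List.map-id l ⟩
  l
    ∎

θ-period : ∀ {m} (x : Vertex (suc m)) → (θ ^ (2 * suc m)) x ≡ x
θ-period {m} x = trans (sym (Vec.cast-is-id refl _)) (Vec.toList-injective refl _ _ (begin
  toList ((θ ^ (2 * suc m)) x)
    ≡⟨ toList-θ^ (2 * suc m) x ⟩
  (θᴸ ^ (suc m + (suc m + 0))) (toList x)
    ≡⟨ cong (λ k → (θᴸ ^ (suc m + k)) (toList x)) (+-identityʳ (suc m)) ⟩
  (θᴸ ^ (suc m + suc m)) (toList x)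
    ≡⟨ cong (λ k → (θᴸ ^ (k + k)) (toList x)) (Vec.length-toList x) ⟨
  (θᴸ ^ (length (toList x) + length (toList x))) (toList x)
    ≡⟨ θᴸ^length+length≡id (toList x) ⟩
  toList x
    ∎))

Linked : ∀ {n} → Vertex n → Vertex n → Set
Linked y x = Alternating (diff y x) ⊎ Alternating (diff x y)

PreservesAlternation : ∀ {n} → (Vertex n → Vertex n) → Set
PreservesAlternation f = ∀ y x → Alternating (diff y x) → Linked (f y) (f x)

PreservesAdj : ∀ {n} → (Vertex n → Vertex n) → Set
PreservesAdj f = ∀ x y → Adj x y → Adj (f x) (f y)

θ-∷ʳ-alternating : ∀ {m} (ys xs : Vertex m) b a →
  Alternating (diff (ys ∷ʳᵥ b) (xs ∷ʳᵥ a)) → Linked (not b ∷ᵥ ys) (not a ∷ᵥ xs)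
θ-∷ʳ-alternating ys xs b a h = byLastEntry b a (subst Alternating (diff-∷ʳ ys xs b a) h)
  where
  byLastEntry : ∀ b a → Alternating (diff ys xs ∷ʳ (bit b - bit a)) → Linked (not b ∷ᵥ ys) (not a ∷ᵥ xs)
  byLastEntry false false h = inj₁ (Alternating-∷ʳ0 (diff ys xs) h)
  byLastEntry true  true  h = inj₁ (Alternating-∷ʳ0 (diff ys xs) h)
  byLastEntry true  false h =
    inj₂ (subst Alternating (cong (+ 1 ∷_) (sym (diff-swap xs ys))) (Alternating-∷ʳ1 (diff ys xs) h))
  byLastEntry false true  h = contradiction h (¬Alternating-∷ʳ-1 (diff ys xs))

θ-preservesAlternation : ∀ {m} → PreservesAlternation (θ {m})
θ-preservesAlternation =
  ∷ʳ-elim (λ y → ∀ x → Alternating (diff y x) → Linked (θ y) (θ x)) λ ys b →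
  ∷ʳ-elim (λ x → Alternating (diff (ys ∷ʳᵥ b) x) → Linked (θ (ys ∷ʳᵥ b)) (θ x)) λ xs a h →
  subst₂ Linked (sym (θ-∷ʳ ys b)) (sym (θ-∷ʳ xs a)) (θ-∷ʳ-alternating ys xs b a h)

τ-preservesAlternation : ∀ {n} → PreservesAlternation (τ {n})
τ-preservesAlternation y x h = inj₁ (subst Alternating (sym (diff-τ y x)) (Alternating-reverse h))

preservesAdj : ∀ {n} (f g : Vertex n → Vertex n) → (∀ x → g (f x) ≡ x) →
  PreservesAlternation f → PreservesAdj f
preservesAdj f g g∘f≗id f-alt x y (x≢y , linked) = f-injective , f-linked linked
  where
  f-injective : f x ≢ f y
  f-injective fx≡fy = x≢y (trans (sym (g∘f≗id x)) (trans (cong g fx≡fy) (g∘f≗id y)))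
  f-linked : Linked y x → Linked (f y) (f x)
  f-linked (inj₁ h) = f-alt y x h
  f-linked (inj₂ h) = swap (f-alt x y h)

PreservesAdj-∘ : ∀ {n} {f g : Vertex n → Vertex n} → PreservesAdj f → PreservesAdj g → PreservesAdj (f ∘ g)
PreservesAdj-∘ {g = g} f-adj g-adj x y h = f-adj (g x) (g y) (g-adj x y h)

PreservesAdj-^ : ∀ {n} {f : Vertex n → Vertex n} → PreservesAdj f → ∀ k → PreservesAdj (f ^ k)
PreservesAdj-^ f-adj zero    x y h = h
PreservesAdj-^ f-adj (suc k) x y h = f-adj _ _ (PreservesAdj-^ f-adj k x y h)

isAutomorphism : ∀ {n} (f g : Vertex n → Vertex n) → (∀ x → g (f x) ≡ x) → (∀ y → f (g y) ≡ y) →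
  PreservesAdj f → PreservesAdj g → IsAutomorphism f
isAutomorphism f g g∘f≗id f∘g≗id f-adj g-adj =
  ( (λ {x} {y} fx≡fy → trans (sym (g∘f≗id x)) (trans (cong g fx≡fy) (g∘f≗id y)))
  , (λ y → g y , λ { refl → f∘g≗id y }) )
  , λ x y → mk⇔ (f-adj x y) (λ h → subst₂ Adj (g∘f≗id x) (g∘f≗id y) (g-adj (f x) (f y) h))

module _ {m : ℕ} where
  private
    N : ℕ
    N = 2 * suc m

  open Periodic (θ {m}) N θ-period

  θ-preservesAdj : PreservesAdj (θ {m})
  θ-preservesAdj = preservesAdj θ (θ ^ (N ∸ 1)) (^-∸-inverseˡ (s≤s z≤n)) θ-preservesAlternation

  τ^ : Bool → Vertex (suc m) → Vertex (suc m)
  τ^ false = id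
  τ^ true  = τ

  τ^-involutive : ∀ e x → τ^ e (τ^ e x) ≡ x
  τ^-involutive false x = refl
  τ^-involutive true  x = Vec.reverse-involutive x

  τ^-preservesAdj : ∀ e → PreservesAdj (τ^ e)
  τ^-preservesAdj false x y h = h
  τ^-preservesAdj true        = preservesAdj τ τ Vec.reverse-involutive τ-preservesAlternation

  act : Dih m → Vertex (suc m) → Vertex (suc m)
  act (e , a) = (θ ^ toℕ a) ∘ τ^ e

  act⁻¹ : Dih m → Vertex (suc m) → Vertex (suc m)
  act⁻¹ (e , a) = τ^ e ∘ (θ ^ (N ∸ toℕ a))

  act⁻¹-act : ∀ g x → act⁻¹ g (act g x) ≡ x
  act⁻¹-act (e , a) x =
    trans (cong (τ^ e) (^-∸-inverseˡ (<⇒≤ (toℕ<n a)) (τ^ e x))) (τ^-involutive e x)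

  act-act⁻¹ : ∀ g y → act g (act⁻¹ g y) ≡ y
  act-act⁻¹ (e , a) y =
    trans (cong (θ ^ toℕ a) (τ^-involutive e _)) (^-∸-inverseʳ (<⇒≤ (toℕ<n a)) y)

  act-isAutomorphism : ∀ g → IsAutomorphism (act g)
  act-isAutomorphism g@(e , a) = isAutomorphism (act g) (act⁻¹ g) (act⁻¹-act g) (act-act⁻¹ g)
    (PreservesAdj-∘ (PreservesAdj-^ θ-preservesAdj (toℕ a)) (τ^-preservesAdj e))
    (PreservesAdj-∘ (τ^-preservesAdj e) (PreservesAdj-^ θ-preservesAdj (N ∸ toℕ a)))

  θ^-τ-θ^ : ∀ k (x : Vertex (suc m)) → (θ ^ k) (τ ((θ ^ k) x)) ≡ τ x
  θ^-τ-θ^ zero    x = refl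
  θ^-τ-θ^ (suc k) x = begin
    (θ ^ suc k) (τ (θ ((θ ^ k) x)))  ≡⟨ ^-sucʳ θ k _ ⟩
    (θ ^ k) (θ (τ (θ ((θ ^ k) x))))  ≡⟨ cong (θ ^ k) (θ-τ-θ ((θ ^ k) x)) ⟩
    (θ ^ k) (τ ((θ ^ k) x))          ≡⟨ θ^-τ-θ^ k x ⟩
    τ x                              ∎

  τ-θ^ : ∀ {k} → k ≤ N → ∀ (x : Vertex (suc m)) → τ ((θ ^ k) x) ≡ (θ ^ (N ∸ k)) (τ x)
  τ-θ^ {k} k≤N x = trans (sym (^-∸-inverseˡ k≤N _)) (cong (θ ^ (N ∸ k)) (θ^-τ-θ^ k x))

  θ^-modN : ∀ j (x : Vertex (suc m)) → (θ ^ toℕ (modN m j)) x ≡ (θ ^ j) x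
  θ^-modN j x = trans (cong (λ k → (θ ^ k) x) (toℕ-fromℕ< (m%n<n j N))) (^-% j x)

  act-hom : ∀ g h x → act (dmul g h) x ≡ act g (act h x)
  act-hom (false , a) (f , b) x = trans (θ^-modN (toℕ a + toℕ b) _) (^-+ θ (toℕ a) (toℕ b) _)
  act-hom (true  , a) (f , b) x = begin
    act (dmul (true , a) (f , b)) x
      ≡⟨ θ^-modN (toℕ a + (N ∸ toℕ b)) _ ⟩
    (θ ^ (toℕ a + (N ∸ toℕ b))) (τ^ (not f) x)
      ≡⟨ ^-+ θ (toℕ a) _ _ ⟩
    (θ ^ toℕ a) ((θ ^ (N ∸ toℕ b)) (τ^ (not f) x))
      ≡⟨ cong ((θ ^ toℕ a) ∘ (θ ^ (N ∸ toℕ b))) (τ^-not f) ⟩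
    (θ ^ toℕ a) ((θ ^ (N ∸ toℕ b)) (τ (τ^ f x)))
      ≡⟨ cong (θ ^ toℕ a) (τ-θ^ (<⇒≤ (toℕ<n b)) _) ⟨
    act (true , a) (act (f , b) x)
      ∎
    where
    τ^-not : ∀ f → τ^ (not f) x ≡ τ (τ^ f x)
    τ^-not false = refl
    τ^-not true  = sym (Vec.reverse-involutive x)

  dihedralAction : DihedralAction m
  dihedralAction = record { act = act ; act-aut = act-isAutomorphism ; act-hom = act-hom }

  act-dr : ∀ x → act dr x ≡ θ x
  act-dr = θ^-modN 1

  act-ds : ∀ x → act ds x ≡ τ x
  act-ds x = θ^-modN 0 (τ x)

theorem4p12 : (m : ℕ) → Σ (DihedralAction m) (λ φ → (∀ x → DihedralAction.act φ dr x ≡ θ x) × (∀ x → DihedralAction.act φ ds x ≡ τ x))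
theorem4p12 m = dihedralAction , act-dr , act-ds
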